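{- Let $G$ be a graph of order $n\geq 2$. The following are equivalent: (1) $G\cong K_{n-r}\sqcup rK_1$ for some $r$ with $n-r\geq 2$; (2) $\operatorname{zir}(G)=n-1$; (3) $\operatorname{Z}(G)=n-1$; (4) $\overline{\operatorname{Z}}(G)=n-1$; (5) $\operatorname{ZIR}(G)=n-1$.
   Context: $\sqcup$ denotes disjoint union and $rK_1$ is $r$ isolated vertices. Zero forcing: from a set $B$ of blue vertices, a blue vertex $u$ may turn a white vertex $w$ blue if $w$ is the only white neighbor of $u$; $B$ is a zero forcing set if eventually all vertices are blue. $\operatorname{Z}(G)$ is the minimum size of a zero forcing set; $\overline{\operatorname{Z}}(G)$ is the maximum size of an inclusion-minimal zero forcing set. A fort is a nonempty $F\subseteq V(G)$ such that every $v\notin F$ has $|F\cap N(v)|\neq 1$. For $S\subseteq V(G)$, $x\in S$, a private fort of $x$ relative to $S$ is a fort $F$ with $S\cap F=\{x\}$; $S$ is a ZIr-set if every element has a private fort. $\operatorname{zir}(G)$ and $\operatorname{ZIR}(G)$ are the minimum and maximum cardinality of an inclusion-maximal ZIr-set of $G$. -}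

module Defs where

open import Data.Nat using (ℕ; _≤_; _<ᵇ_; _∸_)
open import Data.Bool using (Bool; true; false; _∧_; not; if_then_else_)
open import Data.Fin using (Fin; toℕ; _≟_)
open import Data.Fin.Subset using (Subset; _∈_; _∉_; _⊆_; _∩_; ⁅_⁆; ∣_∣; inside; outside)
open import Data.Vec using (tabulate)
open import Data.Product using (Σ; ∃; ∃-syntax; _×_)
open import Relation.Nullary using (¬_; does)
open import Relation.Binary.PropositionalEquality using (_≡_; _≢_)
open import Function.Bundles using (_↔_; Inverse)

record Graph (n : ℕ) : Set where
  field
    adj    : Fin n → Fin n → Bool
    sym    : ∀ u v → adj u v ≡ adj v u
    irrefl : ∀ u → adj u u ≡ false
open Graph public

Adj : ∀ {n} → Graph n → Fin n → Fin n → Set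
Adj G u v = adj G u v ≡ true

N : ∀ {n} → Graph n → Fin n → Subset n
N G v = tabulate (λ u → if adj G v u then inside else outside)

_≅_ : ∀ {n} → Graph n → Graph n → Set
_≅_ {n} G H = Σ (Fin n ↔ Fin n) λ f →
  ∀ u v → adj G u v ≡ adj H (Inverse.to f u) (Inverse.to f v)

-- K_{n-r} ⊔ r K_1 on vertex set Fin n: vertices with index < n - r form
-- a clique, the remaining r vertices are isolated.
KsqcupK1 : (n r : ℕ) → Graph n
KsqcupK1 n r = record
  { adj = A
  ; sym = symp
  ; irrefl = irr }
  where
  open import Relation.Binary.PropositionalEquality using (refl; cong)
  open import Data.Bool.Properties using (∧-comm; ∧-assoc)
  bsym : ∀ {n} (u v : Fin n) → does (u ≟ v) ≡ does (v ≟ u)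
  bsym u v with u ≟ v | v ≟ u
  ... | Relation.Nullary.yes _ | Relation.Nullary.yes _ = refl
  ... | Relation.Nullary.no _ | Relation.Nullary.no _ = refl
  ... | Relation.Nullary.yes refl | Relation.Nullary.no q = Data.Empty.⊥-elim (q refl)
    where import Data.Empty
  ... | Relation.Nullary.no p | Relation.Nullary.yes refl = Data.Empty.⊥-elim (p refl)
    where import Data.Empty
  A : Fin n → Fin n → Bool
  A u v = (toℕ u <ᵇ (n ∸ r)) ∧ (toℕ v <ᵇ (n ∸ r)) ∧ not (does (u ≟ v))
  symp : ∀ u v → A u v ≡ A v u
  symp u v with toℕ u <ᵇ (n ∸ r) | toℕ v <ᵇ (n ∸ r)
  ... | false | false = refl
  ... | false | true = refl
  ... | true | false = refl
  ... | true | true = cong not (bsym u v)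
  irr : ∀ u → A u u ≡ false
  irr u with toℕ u <ᵇ (n ∸ r)
  ... | false = refl
  ... | true with u ≟ u
  ...   | Relation.Nullary.yes _ = refl
  ...   | Relation.Nullary.no p = Data.Empty.⊥-elim (p refl)
    where import Data.Empty

-- Zero forcing closure: the final set of blue vertices obtained from B by
-- repeatedly applying the colour change rule (u blue, w the only white
-- neighbour of u  ⟹  w becomes blue).
data Blue {n} (G : Graph n) (B : Subset n) : Fin n → Set where
  initial : ∀ {w} → w ∈ B → Blue G B w
  force   : ∀ {u w} → Blue G B u → Adj G u w →
            (∀ v → Adj G u v → v ≢ w → Blue G B v) → Blue G B w

IsZFS : ∀ {n} → Graph n → Subset n → Set
IsZFS G B = ∀ v → Blue G B v

IsMinimalZFS : ∀ {n} → Graph n → Subset n → Set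
IsMinimalZFS G B = IsZFS G B × (∀ B′ → B′ ⊆ B → IsZFS G B′ → B ⊆ B′)

IsFort : ∀ {n} → Graph n → Subset n → Set
IsFort G F = (∃[ x ] x ∈ F) × (∀ v → v ∉ F → ∣ F ∩ N G v ∣ ≢ 1)

IsPrivateFort : ∀ {n} → Graph n → Subset n → Fin n → Subset n → Set
IsPrivateFort G S x F = IsFort G F × (S ∩ F ≡ ⁅ x ⁆)

IsZIr : ∀ {n} → Graph n → Subset n → Set
IsZIr G S = ∀ x → x ∈ S → ∃[ F ] IsPrivateFort G S x F

IsMaximalZIr : ∀ {n} → Graph n → Subset n → Set
IsMaximalZIr G S = IsZIr G S × (∀ T → S ⊆ T → IsZIr G T → T ⊆ S)

IsMinCard : ∀ {n} → (Subset n → Set) → ℕ → Set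
IsMinCard P k = (∃[ S ] (P S × ∣ S ∣ ≡ k)) × (∀ S → P S → k ≤ ∣ S ∣)

IsMaxCard : ∀ {n} → (Subset n → Set) → ℕ → Set
IsMaxCard P k = (∃[ S ] (P S × ∣ S ∣ ≡ k)) × (∀ S → P S → ∣ S ∣ ≤ k)

Z≡ : ∀ {n} → Graph n → ℕ → Set
Z≡ G = IsMinCard (IsZFS G)

Zbar≡ : ∀ {n} → Graph n → ℕ → Set
Zbar≡ G = IsMaxCard (IsMinimalZFS G)

zir≡ : ∀ {n} → Graph n → ℕ → Set
zir≡ G = IsMinCard (IsMaximalZIr G)

ZIR≡ : ∀ {n} → Graph n → ℕ → Set
ZIR≡ G = IsMaxCard (IsMaximalZIr G)

{-# OPTIONS --safe #-}
module Submission where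

-- All five conditions are equivalent to: the non-isolated vertices form a clique and there is an
-- edge (listing the non-isolated vertices first identifies such a G with K_{n-r} ⊔ rK_1).
-- In such a graph every pair {u, v} with v non-isolated contains a fort through u ({u} if u is
-- isolated), so zero forcing sets miss at most one vertex, and ∁{v} for non-isolated v is a
-- minimum zero forcing set, a minimal one and a maximal ZIr-set; a maximal ZIr-set misses some
-- non-isolated vertex, so it is such a ∁{v}.  Conversely a set of size n - 1 is some ∁{w}.  If it
-- is a zero forcing set and two non-isolated vertices are non-adjacent, a neighbour of w forces w
-- with a second vertex still white, so a smaller zero forcing set ∁{w, x} exists.  If it is a
-- ZIr-set, the private fort of each x ≠ w lies in {x, w}, so every non-isolated x is adjacent
-- to w and has the same other neighbours as w.

open import Defs hiding (sym)
open import Data.Bool using (true; false; _∧_; not)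
import Data.Bool as Bool
open import Data.Bool.Properties using (¬-not; T-≡; T-∧)
open import Data.Empty using (⊥)
open import Data.Fin using (Fin; zero; suc; toℕ; fromℕ; fromℕ<; punchIn; _≟_)
open import Data.Fin.Permutation using (Permutation; _⟨$⟩ʳ_; _⟨$⟩ˡ_; inverseʳ; lift₀; insert; insert-punchIn)
import Data.Fin.Permutation as Perm
open import Data.Fin.Properties using (any?; toℕ-fromℕ; toℕ-fromℕ<)
open import Data.Fin.Subset using (Subset; _∈_; _∉_; _⊆_; _∩_; _∪_; _-_; ∁; ⁅_⁆; ⊤; ∣_∣; inside; outside)
open import Data.Fin.Subset.Properties
open import Data.Nat using (ℕ; suc; _≤_; _<_; _∸_; _<ᵇ_; z<s)
open import Data.Nat.Properties
  using (_<?_; ≤-trans; ≤-reflexive; <⇒≤; <⇒≢; <⇒≱; ≤⇒≯; <-irrefl; ≤-<-trans; <-≤-trans; <-trans; <ᵇ⇒<;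
         m∸n≤m; ∸-monoʳ-<; m∸[m∸n]≡n; 0≢1+n)
open import Data.Product using (∃; ∃-syntax; _×_; _,_; proj₁; proj₂)
open import Data.Sum using (_⊎_; inj₁; inj₂; [_,_]′)
import Data.Sum as Sum
open import Data.Vec using (_∷_; []; lookup; tabulate)
open import Data.Vec.Properties using (lookup∘tabulate; lookup⇒[]=; []=⇒lookup)
open import Function using (_∘_; id)
open import Function.Bundles using (_⇔_; mk⇔; Equivalence; Injection)
open import Function.Definitions using (Injective)
open import Function.Properties.Equivalence using () renaming (trans to ⇔-trans)
open import Function.Properties.Inverse using (↔⇒↣)
open import Relation.Nullary using (¬_; Dec; yes; no; does; contradiction)
open import Relation.Nullary.Decidable using (dec-true; dec-false; decidable-stable; ¬?; _×-dec_)
open import Relation.Binary.PropositionalEquality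
  using (_≡_; _≢_; refl; sym; trans; cong; cong₂; subst; subst₂; module ≡-Reasoning)

private variable
  n : ℕ
  x y z : Fin n
  p : Subset n

missing⊎full : (p : Subset n) → (∃[ x ] x ∉ p) ⊎ (∀ x → x ∈ p)
missing⊎full p with nonempty? (∁ p)
... | yes (x , x∈∁p) = inj₁ (x , x∈∁p⇒x∉p x∈∁p)
... | no ∁p-empty = inj₂ λ x → x∉∁p⇒x∈p λ x∈∁p → ∁p-empty (x , x∈∁p)

x≢y⇒x∈∁⁅y⁆ : x ≢ y → x ∈ ∁ ⁅ y ⁆
x≢y⇒x∈∁⁅y⁆ x≢y = x∉p⇒x∈∁p (x≢y⇒x∉⁅y⁆ x≢y)

x∈∁⁅y⁆⇒x≢y : x ∈ ∁ ⁅ y ⁆ → x ≢ y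
x∈∁⁅y⁆⇒x≢y {y = y} x∈∁⁅y⁆ refl = x∈∁p⇒x∉p x∈∁⁅y⁆ (x∈⁅x⁆ y)

x∉p⇒p⊆∁⁅x⁆ : x ∉ p → p ⊆ ∁ ⁅ x ⁆
x∉p⇒p⊆∁⁅x⁆ x∉p y∈p = x≢y⇒x∈∁⁅y⁆ λ { refl → x∉p y∈p }

x∈∁⁅y⁆-z : x ≢ y → x ≢ z → x ∈ ∁ ⁅ y ⁆ - z
x∈∁⁅y⁆-z x≢y x≢z = x∈p∧x≢y⇒x∈p-y (x≢y⇒x∈∁⁅y⁆ x≢y) x≢z

x∈p⇒⁅x⁆⊆p : x ∈ p → ⁅ x ⁆ ⊆ p
x∈p⇒⁅x⁆⊆p {x = x} {p = p} x∈p y∈⁅x⁆ = subst (_∈ p) (sym (x∈⁅y⁆⇒x≡y x y∈⁅x⁆)) x∈p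

p≡⁅x⁆⁺ : x ∈ p → (∀ {y} → y ∈ p → y ≡ x) → p ≡ ⁅ x ⁆
p≡⁅x⁆⁺ {x = x} x∈p unique =
  ⊆-antisym (λ y∈p → subst (_∈ ⁅ x ⁆) (sym (unique y∈p)) (x∈⁅x⁆ x)) (x∈p⇒⁅x⁆⊆p x∈p)

p≡⁅x⁆⁻ : p ≡ ⁅ x ⁆ → x ∈ p × (∀ {y} → y ∈ p → y ≡ x)
p≡⁅x⁆⁻ {x = x} refl = x∈⁅x⁆ x , x∈⁅y⁆⇒x≡y x

Empty⇒∣p∣≢1 : (∀ {x} → x ∉ p) → ∣ p ∣ ≢ 1
Empty⇒∣p∣≢1 {n} p-empty ∣p∣≡1 with Empty-unique (λ (_ , x∈p) → p-empty x∈p)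
... | refl = 0≢1+n (trans (sym (∣⊥∣≡0 n)) ∣p∣≡1)

x≢y⇒2≤∣p∣ : x ≢ y → x ∈ p → y ∈ p → 2 ≤ ∣ p ∣
x≢y⇒2≤∣p∣ {x = x} {p = p} x≢y x∈p y∈p = subst (_< ∣ p ∣) (∣⁅x⁆∣≡1 x)
  (p⊂q⇒∣p∣<∣q∣ (x∈p⇒⁅x⁆⊆p x∈p , _ , y∈p , x≢y⇒x∉⁅y⁆ (x≢y ∘ sym)))

∣∁⁅x⁆∣≡n∸1 : ∀ (x : Fin n) → ∣ ∁ ⁅ x ⁆ ∣ ≡ n ∸ 1
∣∁⁅x⁆∣≡n∸1 {n} x = trans (∣∁p∣≡n∸∣p∣ ⁅ x ⁆) (cong (n ∸_) (∣⁅x⁆∣≡1 x))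

x∉p⇒∣p∣≤n∸1 : {p : Subset n} → x ∉ p → ∣ p ∣ ≤ n ∸ 1
x∉p⇒∣p∣≤n∸1 {x = x} x∉p = subst (_ ≤_) (∣∁⁅x⁆∣≡n∸1 x) (p⊆q⇒∣p∣≤∣q∣ (x∉p⇒p⊆∁⁅x⁆ x∉p))

∣∁⁅x⁆-y∣<n∸1 : {x y : Fin n} → y ≢ x → ∣ ∁ ⁅ x ⁆ - y ∣ < n ∸ 1
∣∁⁅x⁆-y∣<n∸1 {x = x} {y} y≢x = subst (∣ ∁ ⁅ x ⁆ - y ∣ <_) (∣∁⁅x⁆∣≡n∸1 x) (x∈p⇒∣p-x∣<∣p∣ (x≢y⇒x∈∁⁅y⁆ y≢x))

n∸1≤∣p∣ : {p : Subset n} → (∀ {x y} → x ≢ y → x ∉ p → y ∉ p → ⊥) → n ∸ 1 ≤ ∣ p ∣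
n∸1≤∣p∣ {n} {p} missesAtMostOne with missing⊎full p
... | inj₁ (x , x∉p) = subst (_≤ ∣ p ∣) (∣∁⁅x⁆∣≡n∸1 x) (p⊆q⇒∣p∣≤∣q∣ ∁⁅x⁆⊆p)
  where
  ∁⁅x⁆⊆p : ∁ ⁅ x ⁆ ⊆ p
  ∁⁅x⁆⊆p {y} y∈∁⁅x⁆ = decidable-stable (y ∈? p) λ y∉p → missesAtMostOne (x∈∁⁅y⁆⇒x≢y y∈∁⁅x⁆) y∉p x∉p
... | inj₂ all∈p = ≤-trans (m∸n≤m n 1) (subst (_≤ ∣ p ∣) (∣⊤∣≡n n) (p⊆q⇒∣p∣≤∣q∣ {p = ⊤} λ _ → all∈p _))

∣p∣≡n∸1⇒p≡∁⁅x⁆ : {p : Subset n} → 1 ≤ n → ∣ p ∣ ≡ n ∸ 1 → ∃[ x ] p ≡ ∁ ⁅ x ⁆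
∣p∣≡n∸1⇒p≡∁⁅x⁆ {n} {p} 1≤n ∣p∣≡n∸1 with missing⊎full p
... | inj₁ (x , x∉p) = x , ⊆-antisym (x∉p⇒p⊆∁⁅x⁆ x∉p) ∁⁅x⁆⊆p
  where
  ∁⁅x⁆⊆p : ∁ ⁅ x ⁆ ⊆ p
  ∁⁅x⁆⊆p {y} y∈∁⁅x⁆ = decidable-stable (y ∈? p) λ y∉p →
    <-irrefl ∣p∣≡n∸1 (≤-<-trans (p⊆q⇒∣p∣≤∣q∣ (p⊆∁⁅x⁆-y y∉p)) (∣∁⁅x⁆-y∣<n∸1 (x∈∁⁅y⁆⇒x≢y y∈∁⁅x⁆)))
    where
    p⊆∁⁅x⁆-y : y ∉ p → p ⊆ ∁ ⁅ x ⁆ - y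
    p⊆∁⁅x⁆-y y∉p z∈p = x∈∁⁅y⁆-z (λ { refl → x∉p z∈p }) (λ { refl → y∉p z∈p })
... | inj₂ all∈p = contradiction (p⊆q⇒∣p∣≤∣q∣ {p = ⊤} λ _ → all∈p _) (<⇒≱ ∣p∣<∣⊤∣)
  where
  ∣p∣<∣⊤∣ : ∣ p ∣ < ∣ ⊤ {n} ∣
  ∣p∣<∣⊤∣ = subst₂ _<_ (sym ∣p∣≡n∸1) (sym (∣⊤∣≡n n)) (∸-monoʳ-< z<s 1≤n)

IsMinCard-const : {P : Subset n → Set} {k : ℕ} → ∃ P → (∀ {S} → P S → ∣ S ∣ ≡ k) → IsMinCard P k
IsMinCard-const (S , PS) ∣_∣≡k = (S , PS , ∣ PS ∣≡k) , λ _ PS′ → ≤-reflexive (sym ∣ PS′ ∣≡k)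

IsMaxCard-const : {P : Subset n → Set} {k : ℕ} → ∃ P → (∀ {S} → P S → ∣ S ∣ ≡ k) → IsMaxCard P k
IsMaxCard-const (S , PS) ∣_∣≡k = (S , PS , ∣ PS ∣≡k) , λ _ PS′ → ≤-reflexive ∣ PS′ ∣≡k

module _ {n : ℕ} (G : Graph n) where

  private variable
    u v w q : Fin n
    B F S T : Subset n

  Adj? : ∀ u v → Dec (Adj G u v)
  Adj? u v = adj G u v Bool.≟ true

  Adj-sym : Adj G u v → Adj G v u
  Adj-sym {u} {v} u~v = trans (Graph.sym G v u) u~v

  Adj⇒≢ : Adj G u v → u ≢ v
  Adj⇒≢ {u} u~u refl = contradiction (trans (sym (irrefl G u)) u~u) λ ()

  lookup-N : lookup (N G v) u ≡ adj G v u
  lookup-N {v} {u} = trans (lookup∘tabulate _ u) (if-inside-outside (adj G v u))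
    where
    if-inside-outside : ∀ b → (Bool.if b then inside else outside) ≡ b
    if-inside-outside true  = refl
    if-inside-outside false = refl

  ∈N⇒Adj : u ∈ N G v → Adj G v u
  ∈N⇒Adj u∈N = trans (sym lookup-N) ([]=⇒lookup u∈N)

  Adj⇒∈N : Adj G v u → u ∈ N G v
  Adj⇒∈N v~u = lookup⇒[]= _ _ (trans lookup-N v~u)

  NonIsolated : Fin n → Set
  NonIsolated v = ∃[ u ] Adj G v u

  NonIsolated? : ∀ v → Dec (NonIsolated v)
  NonIsolated? v = any? (Adj? v)

  NonIsolatedClique : Set
  NonIsolatedClique = ∀ {u v} → NonIsolated u → NonIsolated v → u ≢ v → Adj G u v

  CliquePlusIsolated : Set
  CliquePlusIsolated = NonIsolatedClique × ∃ NonIsolated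

  clique⇒adj≡ : NonIsolatedClique → ∀ u v →
                adj G u v ≡ does (NonIsolated? u) ∧ does (NonIsolated? v) ∧ not (does (u ≟ v))
  clique⇒adj≡ clique u v with NonIsolated? u | NonIsolated? v | u ≟ v
  ... | no ¬nu | _      | _        = ¬-not λ u~v → ¬nu (v , u~v)
  ... | yes _  | no ¬nv | _        = ¬-not λ u~v → ¬nv (u , Adj-sym u~v)
  ... | yes _  | yes _  | yes refl = irrefl G u
  ... | yes nu | yes nv | no u≢v   = clique nu nv u≢v

  fort-noSoleNeighbour : IsFort G F → v ∉ F → u ∈ F → Adj G v u →
                         (∀ {y} → y ∈ F → Adj G v y → y ≡ u) → ⊥
  fort-noSoleNeighbour {F} {v} {u} (_ , outside≢1) v∉F u∈F v~u sole =
    outside≢1 v v∉F (trans (cong ∣_∣ (p≡⁅x⁆⁺ (x∈p∩q⁺ (u∈F , Adj⇒∈N v~u)) unique)) (∣⁅x⁆∣≡1 u))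
    where
    unique : ∀ {y} → y ∈ F ∩ N G v → y ≡ u
    unique y∈ = let y∈F , y∈N = x∈p∩q⁻ F _ y∈ in sole y∈F (∈N⇒Adj y∈N)

  isolated⇒fort : ¬ NonIsolated u → IsFort G ⁅ u ⁆
  isolated⇒fort {u} u-isolated = (u , x∈⁅x⁆ u) , λ v _ → Empty⇒∣p∣≢1 λ y∈ →
    let y∈⁅u⁆ , y∈N = x∈p∩q⁻ ⁅ u ⁆ _ y∈
    in u-isolated (v , Adj-sym (subst (Adj G v) (x∈⁅y⁆⇒x≡y u y∈⁅u⁆) (∈N⇒Adj y∈N)))

  PairFort : Fin n → Fin n → Subset n → Set
  PairFort u v F = IsFort G F × u ∈ F × (∀ {y} → y ∈ F → y ≡ u ⊎ y ≡ v)

  isolated⇒PairFort : ¬ NonIsolated u → PairFort u v ⁅ u ⁆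
  isolated⇒PairFort {u} u-isolated = isolated⇒fort u-isolated , x∈⁅x⁆ u , inj₁ ∘ x∈⁅y⁆⇒x≡y u

  clique⇒PairFort : NonIsolatedClique → NonIsolated v → u ≢ v → ∃[ F ] PairFort u v F
  clique⇒PairFort {v} {u} clique nv u≢v with NonIsolated? u
  ... | no ¬nu = ⁅ u ⁆ , isolated⇒PairFort ¬nu
  ... | yes nu = uv , ((u , u∈uv) , outside≢1) , u∈uv , ⊆uv
    where
    uv : Subset n
    uv = ⁅ u ⁆ ∪ ⁅ v ⁆
    u∈uv : u ∈ uv
    u∈uv = x∈p∪q⁺ (inj₁ (x∈⁅x⁆ u))
    v∈uv : v ∈ uv
    v∈uv = x∈p∪q⁺ (inj₂ (x∈⁅x⁆ v))
    ⊆uv : ∀ {y} → y ∈ uv → y ≡ u ⊎ y ≡ v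
    ⊆uv y∈uv = Sum.map (x∈⁅y⁆⇒x≡y u) (x∈⁅y⁆⇒x≡y v) (x∈p∪q⁻ ⁅ u ⁆ ⁅ v ⁆ y∈uv)
    outside≢1 : ∀ w → w ∉ uv → ∣ uv ∩ N G w ∣ ≢ 1
    outside≢1 w w∉uv with NonIsolated? w
    ... | yes nw = λ ∣uv∩N∣≡1 →
      <⇒≢ (subst (2 ≤_) ∣uv∩N∣≡1 (x≢y⇒2≤∣p∣ u≢v (neighbour u∈uv nu) (neighbour v∈uv nv))) refl
      where
      neighbour : ∀ {y} → y ∈ uv → NonIsolated y → y ∈ uv ∩ N G w
      neighbour y∈uv ny = x∈p∩q⁺ (y∈uv , Adj⇒∈N (clique nw ny λ { refl → w∉uv y∈uv }))
    ... | no ¬nw = Empty⇒∣p∣≢1 λ y∈ → ¬nw (_ , ∈N⇒Adj (proj₂ (x∈p∩q⁻ uv _ y∈)))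

  PairFort-adj : PairFort u v F → w ≢ u → w ≢ v → Adj G w u → Adj G w v
  PairFort-adj {u} {v} {F} {w} (fort , u∈F , ⊆uv) w≢u w≢v w~u = decidable-stable (Adj? w v) λ w≁v →
    fort-noSoleNeighbour fort w∉F u∈F w~u λ y∈F w~y →
      [ id , (λ { refl → contradiction w~y w≁v }) ]′ (⊆uv y∈F)
    where
    w∉F : w ∉ F
    w∉F w∈F = [ w≢u , w≢v ]′ (⊆uv w∈F)

  PairFort-swap : PairFort u v F → NonIsolated u → PairFort v u F
  PairFort-swap {u} {v} {F} (fort , u∈F , ⊆uv) (q , u~q) = fort , v∈F , Sum.swap ∘ ⊆uv
    where
    v∈F : v ∈ F
    v∈F = decidable-stable (v ∈? F) λ v∉F →
      let only-u : ∀ {y} → y ∈ F → y ≡ u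
          only-u y∈F = [ id , (λ { refl → contradiction y∈F v∉F }) ]′ (⊆uv y∈F)
      in fort-noSoleNeighbour fort (λ q∈F → Adj⇒≢ u~q (sym (only-u q∈F))) u∈F (Adj-sym u~q)
           λ y∈F _ → only-u y∈F

  privateFort⇒PairFort : IsPrivateFort G (∁ ⁅ v ⁆) u F → PairFort u v F
  privateFort⇒PairFort {v} {u} {F} (fort , ∁⁅v⁆∩F≡⁅u⁆) with p≡⁅x⁆⁻ ∁⁅v⁆∩F≡⁅u⁆
  ... | u∈∁⁅v⁆∩F , only-u = fort , proj₂ (x∈p∩q⁻ _ F u∈∁⁅v⁆∩F) , ⊆uv
    where
    ⊆uv : ∀ {y} → y ∈ F → y ≡ u ⊎ y ≡ v
    ⊆uv {y} y∈F with y ≟ v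
    ... | yes y≡v = inj₂ y≡v
    ... | no y≢v = inj₁ (only-u (x∈p∩q⁺ (x≢y⇒x∈∁⁅y⁆ y≢v , y∈F)))

  PairFort⇒privateFort : u ≢ v → PairFort u v F → IsPrivateFort G (∁ ⁅ v ⁆) u F
  PairFort⇒privateFort {u} {v} {F} u≢v (fort , u∈F , ⊆uv) =
    fort , p≡⁅x⁆⁺ (x∈p∩q⁺ (x≢y⇒x∈∁⁅y⁆ u≢v , u∈F)) only-u
    where
    only-u : ∀ {y} → y ∈ ∁ ⁅ v ⁆ ∩ F → y ≡ u
    only-u y∈ = let y∈∁⁅v⁆ , y∈F = x∈p∩q⁻ _ _ y∈ in
      [ id , (λ y≡v → contradiction y≡v (x∈∁⁅y⁆⇒x≢y y∈∁⁅v⁆)) ]′ (⊆uv y∈F)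

  Blue⇒∉fort : IsFort G F → (∀ {y} → y ∈ B → y ∉ F) → Blue G B u → u ∉ F
  Blue⇒∉fort fort B∩F≡∅ (initial u∈B) = B∩F≡∅ u∈B
  Blue⇒∉fort {F} {u = u} fort B∩F≡∅ (force {v} v-blue v~u others) u∈F =
    fort-noSoleNeighbour fort (Blue⇒∉fort fort B∩F≡∅ v-blue) u∈F v~u sole
    where
    sole : ∀ {y} → y ∈ F → Adj G v y → y ≡ u
    sole {y} y∈F v~y = decidable-stable (y ≟ u) λ y≢u → Blue⇒∉fort fort B∩F≡∅ (others y v~y y≢u) y∈F

  ZFS-meets-fort : IsZFS G B → IsFort G F → ¬ (∀ {y} → y ∈ B → y ∉ F)
  ZFS-meets-fort zfs fort@((u , u∈F) , _) B∩F≡∅ = Blue⇒∉fort fort B∩F≡∅ (zfs u) u∈F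

  ZFS-meets-PairFort : IsZFS G B → PairFort u v F → u ∉ B → v ∉ B → ⊥
  ZFS-meets-PairFort zfs (fort , _ , ⊆uv) u∉B v∉B = ZFS-meets-fort zfs fort λ y∈B y∈F →
    [ (λ { refl → u∉B y∈B }) , (λ { refl → v∉B y∈B }) ]′ (⊆uv y∈F)

  clique⇒ZFS-misses≤1 : NonIsolatedClique → IsZFS G B → u ≢ v → u ∉ B → v ∉ B → ⊥
  clique⇒ZFS-misses≤1 {v = v} clique zfs u≢v u∉B v∉B with NonIsolated? v
  ... | yes nv = ZFS-meets-PairFort zfs (proj₂ (clique⇒PairFort clique nv u≢v)) u∉B v∉B
  ... | no ¬nv = ZFS-meets-PairFort zfs (isolated⇒PairFort ¬nv) v∉B u∉B

  force-last : (∀ {y} → y ≢ u → Blue G B y) → NonIsolated u → Blue G B u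
  force-last others (v , u~v) = force (others (Adj⇒≢ u~v ∘ sym)) (Adj-sym u~v) λ _ _ y≢u → others y≢u

  ∁⁅u⁆-ZFS : NonIsolated u → IsZFS G (∁ ⁅ u ⁆)
  ∁⁅u⁆-ZFS {u} nu y with y ≟ u
  ... | yes refl = force-last (initial ∘ x≢y⇒x∈∁⁅y⁆) nu
  ... | no y≢u = initial (x≢y⇒x∈∁⁅y⁆ y≢u)

  -- q forces w, after which everything but u is blue, and u is forced by any neighbour.
  ∁pair-ZFS : Adj G q w → ¬ Adj G q u → q ≢ u → NonIsolated u →
              (∀ {y} → y ≢ w → y ≢ u → y ∈ B) → IsZFS G B
  ∁pair-ZFS {q} {w} {u} {B} q~w q≁u q≢u nu ⊇ = all-blue
    where
    w-blue : Blue G B w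
    w-blue = force (initial (⊇ (Adj⇒≢ q~w) q≢u)) q~w λ y q~y y≢w → initial (⊇ y≢w λ { refl → q≁u q~y })
    but-u-blue : ∀ {y} → y ≢ u → Blue G B y
    but-u-blue {y} y≢u with y ≟ w
    ... | yes refl = w-blue
    ... | no y≢w = initial (⊇ y≢w y≢u)
    all-blue : IsZFS G B
    all-blue y with y ≟ u
    ... | yes refl = force-last but-u-blue nu
    ... | no y≢u = but-u-blue y≢u

  nonNeighbour⇒ZFS : NonIsolated w → NonIsolated u → u ≢ w → ¬ Adj G w u →
                     ∃[ x ] x ≢ w × IsZFS G (∁ ⁅ w ⁆ - x)
  nonNeighbour⇒ZFS {w} {u} (q , w~q) nu u≢w w≁u with Adj? q u
  ... | no q≁u = u , u≢w , ∁pair-ZFS (Adj-sym w~q) q≁u (λ { refl → w≁u w~q }) nu x∈∁⁅y⁆-z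
  ... | yes q~u = q , (Adj⇒≢ w~q ∘ sym) ,
                  ∁pair-ZFS (Adj-sym q~u) (w≁u ∘ Adj-sym) u≢w (q , w~q) λ y≢q y≢w → x∈∁⁅y⁆-z y≢w y≢q

  nonClique⇒ZFS : NonIsolated w → NonIsolated u → NonIsolated v → u ≢ v → ¬ Adj G u v →
                  ∃[ x ] x ≢ w × IsZFS G (∁ ⁅ w ⁆ - x)
  nonClique⇒ZFS {w} {u} {v} nw nu nv u≢v u≁v with v ≟ w
  ... | yes refl = nonNeighbour⇒ZFS nw nu u≢v (u≁v ∘ Adj-sym)
  ... | no v≢w with Adj? w v
  ...   | no w≁v = nonNeighbour⇒ZFS nw nv v≢w w≁v
  ...   | yes w~v = u , (λ { refl → u≁v w~v }) ,
                    ∁pair-ZFS (Adj-sym w~v) (u≁v ∘ Adj-sym) (u≢v ∘ sym) nu x∈∁⁅y⁆-z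

  irreducibleZFS⇒CliquePlusIsolated : IsZFS G (∁ ⁅ w ⁆) → (∀ {x} → x ≢ w → ¬ IsZFS G (∁ ⁅ w ⁆ - x)) →
                                      CliquePlusIsolated
  irreducibleZFS⇒CliquePlusIsolated {w} zfs irreducible = clique , w , nw
    where
    nw : NonIsolated w
    nw = decidable-stable (NonIsolated? w) λ ¬nw → ZFS-meets-fort zfs (isolated⇒fort ¬nw)
      λ y∈∁⁅w⁆ y∈⁅w⁆ → x∈∁⁅y⁆⇒x≢y y∈∁⁅w⁆ (x∈⁅y⁆⇒x≡y w y∈⁅w⁆)
    clique : NonIsolatedClique
    clique nu nv u≢v = decidable-stable (Adj? _ _) λ u≁v →
      let x , x≢w , zfs′ = nonClique⇒ZFS nw nu nv u≢v u≁v in irreducible x≢w zfs′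

  ZIr-closedNbhd⇒isolated : IsZIr G T → q ∈ T → (∀ {y} → Adj G q y → y ∈ T) → ¬ NonIsolated q
  ZIr-closedNbhd⇒isolated {T} {q} zir q∈T N[q]⊆T (u , q~u) with zir u (N[q]⊆T q~u)
  ... | F , fort , T∩F≡⁅u⁆ =
    fort-noSoleNeighbour fort q∉F u∈F q~u λ y∈F q~y → only-u (x∈p∩q⁺ (N[q]⊆T q~y , y∈F))
    where
    only-u : ∀ {y} → y ∈ T ∩ F → y ≡ u
    only-u = proj₂ (p≡⁅x⁆⁻ T∩F≡⁅u⁆)
    u∈F : u ∈ F
    u∈F = proj₂ (x∈p∩q⁻ T F (proj₁ (p≡⁅x⁆⁻ T∩F≡⁅u⁆)))
    q∉F : q ∉ F
    q∉F q∈F = Adj⇒≢ q~u (only-u (x∈p∩q⁺ (q∈T , q∈F)))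

  ZIr-misses-nonIsolated : IsZIr G S → NonIsolated q → ∃[ u ] NonIsolated u × u ∉ S
  ZIr-misses-nonIsolated {S} {q} zir nq with q ∈? S
  ... | no q∉S = q , nq , q∉S
  ... | yes q∈S with any? (λ y → Adj? q y ×-dec ¬? (y ∈? S))
  ...   | yes (u , q~u , u∉S) = u , (q , Adj-sym q~u) , u∉S
  ...   | no ¬N[q]⊈S = contradiction nq (ZIr-closedNbhd⇒isolated zir q∈S λ {y} q~y →
            decidable-stable (y ∈? S) λ y∉S → ¬N[q]⊈S (y , q~y , y∉S))

  ∁⁅v⁆-ZIr : NonIsolatedClique → NonIsolated v → IsZIr G (∁ ⁅ v ⁆)
  ∁⁅v⁆-ZIr clique nv u u∈∁⁅v⁆ =
    let u≢v = x∈∁⁅y⁆⇒x≢y u∈∁⁅v⁆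
        F , pairFort = clique⇒PairFort clique nv u≢v
    in F , PairFort⇒privateFort u≢v pairFort

  ∁⁅v⁆-maximalZIr : NonIsolatedClique → NonIsolated v → IsMaximalZIr G (∁ ⁅ v ⁆)
  ∁⁅v⁆-maximalZIr {v} clique nv@(q , v~q) = ∁⁅v⁆-ZIr clique nv , maximal
    where
    maximal : ∀ T → ∁ ⁅ v ⁆ ⊆ T → IsZIr G T → T ⊆ ∁ ⁅ v ⁆
    maximal T ∁⁅v⁆⊆T zir {u} u∈T = x≢y⇒x∈∁⁅y⁆ λ { refl →
      ZIr-closedNbhd⇒isolated zir (everything∈T u∈T q) (λ _ → everything∈T u∈T _) (v , Adj-sym v~q) }
      where
      everything∈T : v ∈ T → ∀ y → y ∈ T
      everything∈T v∈T y with y ≟ v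
      ... | yes refl = v∈T
      ... | no y≢v = ∁⁅v⁆⊆T (x≢y⇒x∈∁⁅y⁆ y≢v)

  maximalZIr≡∁⁅u⁆ : NonIsolatedClique → NonIsolated q → IsMaximalZIr G S → ∃[ u ] S ≡ ∁ ⁅ u ⁆
  maximalZIr≡∁⁅u⁆ {S = S} clique nq (zir , maximal) with ZIr-misses-nonIsolated zir nq
  ... | u , nu , u∉S = u , ⊆-antisym S⊆∁⁅u⁆ (maximal _ S⊆∁⁅u⁆ (∁⁅v⁆-ZIr clique nu))
    where
    S⊆∁⁅u⁆ : S ⊆ ∁ ⁅ u ⁆
    S⊆∁⁅u⁆ = x∉p⇒p⊆∁⁅x⁆ u∉S

  allIsolated⇒⊤-ZIr : (∀ u → ¬ NonIsolated u) → IsZIr G ⊤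
  allIsolated⇒⊤-ZIr isolated u _ = ⁅ u ⁆ , isolated⇒fort (isolated u) , ∩-identityˡ ⁅ u ⁆

  ∁⁅w⁆-ZIr⇒PairFort : IsZIr G (∁ ⁅ w ⁆) → u ≢ w → ∃[ F ] PairFort u w F
  ∁⁅w⁆-ZIr⇒PairFort zir u≢w =
    let F , privateFort = zir _ (x≢y⇒x∈∁⁅y⁆ u≢w) in F , privateFort⇒PairFort privateFort

  ∁⁅w⁆-ZIr⇒Adj : IsZIr G (∁ ⁅ w ⁆) → v ≢ w → NonIsolated v → Adj G v w
  ∁⁅w⁆-ZIr⇒Adj {w} zir v≢w (u , v~u) with u ≟ w
  ... | yes refl = v~u
  ... | no u≢w = PairFort-adj (proj₂ (∁⁅w⁆-ZIr⇒PairFort zir u≢w)) (Adj⇒≢ v~u) v≢w v~u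

  ∁⁅w⁆-ZIr⇒clique : IsZIr G (∁ ⁅ w ⁆) → NonIsolatedClique
  ∁⁅w⁆-ZIr⇒clique {w} zir {u} {v} nu nv u≢v with u ≟ w | v ≟ w
  ... | yes refl | _ = Adj-sym (∁⁅w⁆-ZIr⇒Adj zir (u≢v ∘ sym) nv)
  ... | no _ | yes refl = ∁⁅w⁆-ZIr⇒Adj zir u≢v nu
  ... | no u≢w | no v≢w with ∁⁅w⁆-ZIr⇒PairFort zir u≢w
  ...   | _ , uwFort =
    Adj-sym (PairFort-adj (PairFort-swap uwFort nu) v≢w (u≢v ∘ sym) (∁⁅w⁆-ZIr⇒Adj zir v≢w nv))

  maximalZIr∁⁅w⁆⇒CliquePlusIsolated : IsMaximalZIr G (∁ ⁅ w ⁆) → CliquePlusIsolated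
  maximalZIr∁⁅w⁆⇒CliquePlusIsolated {w} (zir , maximal) = ∁⁅w⁆-ZIr⇒clique zir , w , nw
    where
    nw : NonIsolated w
    nw = decidable-stable (NonIsolated? w) λ ¬nw →
      x∈∁⁅y⁆⇒x≢y (maximal ⊤ (λ _ → ∈⊤) (allIsolated⇒⊤-ZIr (isolated ¬nw)) ∈⊤) refl
      where
      isolated : ¬ NonIsolated w → ∀ v → ¬ NonIsolated v
      isolated ¬nw v nv with v ≟ w
      ... | yes refl = ¬nw nv
      ... | no v≢w = ¬nw (v , Adj-sym (∁⁅w⁆-ZIr⇒Adj zir v≢w nv))

  CliquePlusIsolated⇒Z≡n∸1 : CliquePlusIsolated → Z≡ G (n ∸ 1)
  CliquePlusIsolated⇒Z≡n∸1 (clique , u , nu) =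
    (∁ ⁅ u ⁆ , ∁⁅u⁆-ZFS nu , ∣∁⁅x⁆∣≡n∸1 u) , λ _ zfs → n∸1≤∣p∣ (clique⇒ZFS-misses≤1 clique zfs)

  Z≡n∸1⇒CliquePlusIsolated : 1 ≤ n → Z≡ G (n ∸ 1) → CliquePlusIsolated
  Z≡n∸1⇒CliquePlusIsolated 1≤n ((S , zfs , ∣S∣≡n∸1) , minimum)
    with ∣p∣≡n∸1⇒p≡∁⁅x⁆ {p = S} 1≤n ∣S∣≡n∸1
  ... | w , refl = irreducibleZFS⇒CliquePlusIsolated zfs λ x≢w zfs′ →
    <⇒≱ (∣∁⁅x⁆-y∣<n∸1 x≢w) (minimum _ zfs′)

  CliquePlusIsolated⇒Zbar≡n∸1 : CliquePlusIsolated → Zbar≡ G (n ∸ 1)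
  CliquePlusIsolated⇒Zbar≡n∸1 (clique , u , nu) =
    (∁ ⁅ u ⁆ , (∁⁅u⁆-ZFS nu , minimal) , ∣∁⁅x⁆∣≡n∸1 u) , maximum
    where
    minimal : ∀ B → B ⊆ ∁ ⁅ u ⁆ → IsZFS G B → ∁ ⁅ u ⁆ ⊆ B
    minimal B B⊆∁⁅u⁆ zfs {y} y∈∁⁅u⁆ = decidable-stable (y ∈? B) λ y∉B →
      clique⇒ZFS-misses≤1 clique zfs (x∈∁⁅y⁆⇒x≢y y∈∁⁅u⁆) y∉B λ u∈B → x∈∁⁅y⁆⇒x≢y (B⊆∁⁅u⁆ u∈B) refl
    maximum : ∀ S → IsMinimalZFS G S → ∣ S ∣ ≤ n ∸ 1
    maximum S (_ , minimalS) with missing⊎full S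
    ... | inj₁ (_ , x∉S) = x∉p⇒∣p∣≤n∸1 x∉S
    ... | inj₂ all∈S = contradiction refl (x∈∁⁅y⁆⇒x≢y (minimalS _ (λ _ → all∈S _) (∁⁅u⁆-ZFS nu) (all∈S u)))

  Zbar≡n∸1⇒CliquePlusIsolated : 1 ≤ n → Zbar≡ G (n ∸ 1) → CliquePlusIsolated
  Zbar≡n∸1⇒CliquePlusIsolated 1≤n ((S , (zfs , minimal) , ∣S∣≡n∸1) , _)
    with ∣p∣≡n∸1⇒p≡∁⁅x⁆ {p = S} 1≤n ∣S∣≡n∸1
  ... | w , refl = irreducibleZFS⇒CliquePlusIsolated zfs λ {x} x≢w zfs′ →
    <⇒≱ (∣∁⁅x⁆-y∣<n∸1 x≢w)
        (subst (_≤ ∣ ∁ ⁅ w ⁆ - x ∣) (∣∁⁅x⁆∣≡n∸1 w) (p⊆q⇒∣p∣≤∣q∣ (minimal _ (p─q⊆p _ _) zfs′)))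

  CliquePlusIsolated⇒maximalZIr : CliquePlusIsolated → ∃ (IsMaximalZIr G)
  CliquePlusIsolated⇒maximalZIr (clique , u , nu) = ∁ ⁅ u ⁆ , ∁⁅v⁆-maximalZIr clique nu

  CliquePlusIsolated⇒∣maximalZIr∣≡n∸1 : CliquePlusIsolated → IsMaximalZIr G S → ∣ S ∣ ≡ n ∸ 1
  CliquePlusIsolated⇒∣maximalZIr∣≡n∸1 {S} (clique , _ , nq) maximal
    with maximalZIr≡∁⁅u⁆ {S = S} clique nq maximal
  ... | u , refl = ∣∁⁅x⁆∣≡n∸1 u

  maximalZIr-n∸1⇒CliquePlusIsolated : 1 ≤ n → IsMaximalZIr G S → ∣ S ∣ ≡ n ∸ 1 → CliquePlusIsolated
  maximalZIr-n∸1⇒CliquePlusIsolated {S} 1≤n maximal ∣S∣≡n∸1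
    with ∣p∣≡n∸1⇒p≡∁⁅x⁆ {p = S} 1≤n ∣S∣≡n∸1
  ... | _ , refl = maximalZIr∁⁅w⁆⇒CliquePlusIsolated maximal

  CliquePlusIsolated⇔zir≡n∸1 : 1 ≤ n → CliquePlusIsolated ⇔ zir≡ G (n ∸ 1)
  CliquePlusIsolated⇔zir≡n∸1 1≤n = mk⇔
    (λ cpi → IsMinCard-const (CliquePlusIsolated⇒maximalZIr cpi) (CliquePlusIsolated⇒∣maximalZIr∣≡n∸1 cpi))
    (λ ((_ , maximal , ∣S∣≡n∸1) , _) → maximalZIr-n∸1⇒CliquePlusIsolated 1≤n maximal ∣S∣≡n∸1)

  CliquePlusIsolated⇔ZIR≡n∸1 : 1 ≤ n → CliquePlusIsolated ⇔ ZIR≡ G (n ∸ 1)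
  CliquePlusIsolated⇔ZIR≡n∸1 1≤n = mk⇔
    (λ cpi → IsMaxCard-const (CliquePlusIsolated⇒maximalZIr cpi) (CliquePlusIsolated⇒∣maximalZIr∣≡n∸1 cpi))
    (λ ((_ , maximal , ∣S∣≡n∸1) , _) → maximalZIr-n∸1⇒CliquePlusIsolated 1≤n maximal ∣S∣≡n∸1)

  CliquePlusIsolated⇔Z≡n∸1 : 1 ≤ n → CliquePlusIsolated ⇔ Z≡ G (n ∸ 1)
  CliquePlusIsolated⇔Z≡n∸1 1≤n = mk⇔ CliquePlusIsolated⇒Z≡n∸1 (Z≡n∸1⇒CliquePlusIsolated 1≤n)

  CliquePlusIsolated⇔Zbar≡n∸1 : 1 ≤ n → CliquePlusIsolated ⇔ Zbar≡ G (n ∸ 1)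
  CliquePlusIsolated⇔Zbar≡n∸1 1≤n = mk⇔ CliquePlusIsolated⇒Zbar≡n∸1 (Zbar≡n∸1⇒CliquePlusIsolated 1≤n)

CliquePlusIsolated-≅ : (G H : Graph n) → G ≅ H → CliquePlusIsolated H → CliquePlusIsolated G
CliquePlusIsolated-≅ {n} G H (f , f-adj) (cliqueH , u , v , u~v) =
  clique , f ⟨$⟩ˡ u , f ⟨$⟩ˡ v , trans (f-adj _ _) (subst₂ (Adj H) (sym (inverseʳ f)) (sym (inverseʳ f)) u~v)
  where
  nonIsolated : ∀ {x} → NonIsolated G x → NonIsolated H (f ⟨$⟩ʳ x)
  nonIsolated {x} (y , x~y) = f ⟨$⟩ʳ y , trans (sym (f-adj x y)) x~y
  clique : NonIsolatedClique G
  clique {x} {y} nx ny x≢y =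
    trans (f-adj x y) (cliqueH (nonIsolated nx) (nonIsolated ny) (x≢y ∘ Injection.injective (↔⇒↣ f)))

module _ (n r : ℕ) where

  KsqcupK1-adj⇒< : {u v : Fin n} → Adj (KsqcupK1 n r) u v → toℕ u < n ∸ r
  KsqcupK1-adj⇒< u~v = <ᵇ⇒< _ _ (proj₁ (Equivalence.to T-∧ (Equivalence.from T-≡ u~v)))

  <⇒KsqcupK1-adj : {u v : Fin n} → toℕ u < n ∸ r → toℕ v < n ∸ r → u ≢ v → Adj (KsqcupK1 n r) u v
  <⇒KsqcupK1-adj {u} {v} u<n∸r v<n∸r u≢v =
    cong₂ _∧_ (dec-true (_ <? _) u<n∸r)
              (cong₂ _∧_ (dec-true (_ <? _) v<n∸r) (cong not (dec-false (u ≟ v) u≢v)))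

  KsqcupK1-CliquePlusIsolated : 2 ≤ n ∸ r → CliquePlusIsolated (KsqcupK1 n r)
  KsqcupK1-CliquePlusIsolated 2≤n∸r =
    clique , vertex 0<n∸r , vertex 2≤n∸r , <⇒KsqcupK1-adj (vertex< 0<n∸r) (vertex< 2≤n∸r) vertex0≢vertex1
    where
    clique : NonIsolatedClique (KsqcupK1 n r)
    clique (_ , u~) (_ , v~) u≢v = <⇒KsqcupK1-adj (KsqcupK1-adj⇒< u~) (KsqcupK1-adj⇒< v~) u≢v
    0<n∸r : 0 < n ∸ r
    0<n∸r = <-trans z<s 2≤n∸r
    vertex : ∀ {i} → i < n ∸ r → Fin n
    vertex i<n∸r = fromℕ< (<-≤-trans i<n∸r (m∸n≤m n r))
    vertex< : ∀ {i} (i<n∸r : i < n ∸ r) → toℕ (vertex i<n∸r) < n ∸ r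
    vertex< i<n∸r = subst (_< n ∸ r) (sym (toℕ-fromℕ< _)) i<n∸r
    vertex0≢vertex1 : vertex 0<n∸r ≢ vertex 2≤n∸r
    vertex0≢vertex1 eq = 0≢1+n (trans (sym (toℕ-fromℕ< _)) (trans (cong toℕ eq) (toℕ-fromℕ< _)))

does-≟-injective : ∀ {m k} {f : Fin m → Fin k} → Injective _≡_ _≡_ f →
                   ∀ x y → does (f x ≟ f y) ≡ does (x ≟ y)
does-≟-injective {f = f} f-injective x y with x ≟ y
... | yes refl = dec-true (f x ≟ f x) refl
... | no x≢y = dec-false (f x ≟ f y) (x≢y ∘ f-injective)

toℕ-punchIn-fromℕ : ∀ {m} (i : Fin m) → toℕ (punchIn (fromℕ m) i) ≡ toℕ i
toℕ-punchIn-fromℕ zero = refl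
toℕ-punchIn-fromℕ (suc i) = cong suc (toℕ-punchIn-fromℕ i)

prefix-permutation : ∀ {m} (C : Subset m) → ∃[ π ] ∀ x → (toℕ (π ⟨$⟩ʳ x) <ᵇ ∣ C ∣) ≡ lookup C x
prefix-permutation [] = Perm.id , λ ()
prefix-permutation (inside ∷ C) with prefix-permutation C
... | π , π-prefix = lift₀ π , λ { zero → refl ; (suc x) → π-prefix x }
prefix-permutation {suc m} (outside ∷ C) with prefix-permutation C
... | π , π-prefix = insert zero (fromℕ m) π , λ
  { zero    → last∉prefix
  ; (suc x) → trans (cong (_<ᵇ ∣ C ∣) (toℕ-suc x)) (π-prefix x) }
  where
  last∉prefix : (toℕ (fromℕ m) <ᵇ ∣ C ∣) ≡ false
  last∉prefix =
    dec-false (toℕ (fromℕ m) <? ∣ C ∣) (≤⇒≯ (subst (∣ C ∣ ≤_) (sym (toℕ-fromℕ m)) (∣p∣≤n C)))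
  toℕ-suc : ∀ x → toℕ (insert zero (fromℕ m) π ⟨$⟩ʳ suc x) ≡ toℕ (π ⟨$⟩ʳ x)
  toℕ-suc x = trans (cong toℕ (insert-punchIn zero (fromℕ m) π x)) (toℕ-punchIn-fromℕ (π ⟨$⟩ʳ x))

CliquePlusIsolated⇒≅KsqcupK1 : (G : Graph n) → CliquePlusIsolated G →
                               ∃[ r ] (2 ≤ n ∸ r × G ≅ KsqcupK1 n r)
CliquePlusIsolated⇒≅KsqcupK1 {n} G (clique , u , v , u~v) =
  n ∸ ∣ C ∣ , subst (2 ≤_) (sym n∸[n∸∣C∣]≡∣C∣) 2≤∣C∣ , π , π-adj
  where
  C : Subset n
  C = tabulate (does ∘ NonIsolated? G)
  lookup-C : ∀ x → lookup C x ≡ does (NonIsolated? G x)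
  lookup-C = lookup∘tabulate (does ∘ NonIsolated? G)
  ∈C : ∀ {x} → NonIsolated G x → x ∈ C
  ∈C {x} nx = lookup⇒[]= x C (trans (lookup-C x) (dec-true (NonIsolated? G x) nx))
  2≤∣C∣ : 2 ≤ ∣ C ∣
  2≤∣C∣ = x≢y⇒2≤∣p∣ (Adj⇒≢ G u~v) (∈C (v , u~v)) (∈C (u , Adj-sym G u~v))
  n∸[n∸∣C∣]≡∣C∣ : n ∸ (n ∸ ∣ C ∣) ≡ ∣ C ∣
  n∸[n∸∣C∣]≡∣C∣ = m∸[m∸n]≡n (∣p∣≤n C)
  π : Permutation n n
  π = proj₁ (prefix-permutation C)
  inPrefix : ∀ x → does (NonIsolated? G x) ≡ (toℕ (π ⟨$⟩ʳ x) <ᵇ ∣ C ∣)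
  inPrefix x = sym (trans (proj₂ (prefix-permutation C) x) (lookup-C x))
  π-adj : ∀ x y → adj G x y ≡ adj (KsqcupK1 n (n ∸ ∣ C ∣)) (π ⟨$⟩ʳ x) (π ⟨$⟩ʳ y)
  π-adj x y = begin
    adj G x y
      ≡⟨ clique⇒adj≡ G clique x y ⟩
    does (NonIsolated? G x) ∧ does (NonIsolated? G y) ∧ not (does (x ≟ y))
      ≡⟨ cong₂ _∧_ (inPrefix x)
                   (cong₂ _∧_ (inPrefix y) (cong not (sym (does-≟-injective π-injective x y)))) ⟩
    (toℕ (π ⟨$⟩ʳ x) <ᵇ ∣ C ∣) ∧ (toℕ (π ⟨$⟩ʳ y) <ᵇ ∣ C ∣) ∧ not (does (π ⟨$⟩ʳ x ≟ π ⟨$⟩ʳ y))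
      ≡⟨ cong (λ k → (toℕ (π ⟨$⟩ʳ x) <ᵇ k) ∧ (toℕ (π ⟨$⟩ʳ y) <ᵇ k) ∧ not (does (π ⟨$⟩ʳ x ≟ π ⟨$⟩ʳ y)))
              (sym n∸[n∸∣C∣]≡∣C∣) ⟩
    adj (KsqcupK1 n (n ∸ ∣ C ∣)) (π ⟨$⟩ʳ x) (π ⟨$⟩ʳ y) ∎
    where
    open ≡-Reasoning
    π-injective : Injective _≡_ _≡_ (π ⟨$⟩ʳ_)
    π-injective = Injection.injective (↔⇒↣ π)

≅KsqcupK1⇔CliquePlusIsolated : (G : Graph n) →
                               (∃[ r ] (2 ≤ n ∸ r × G ≅ KsqcupK1 n r)) ⇔ CliquePlusIsolated G
≅KsqcupK1⇔CliquePlusIsolated {n} G = mk⇔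
  (λ (r , 2≤n∸r , G≅K) → CliquePlusIsolated-≅ G (KsqcupK1 n r) G≅K (KsqcupK1-CliquePlusIsolated n r 2≤n∸r))
  (CliquePlusIsolated⇒≅KsqcupK1 G)

proposition5p2 : (n : ℕ) → 2 ≤ n → (G : Graph n) →
    let cond1 = ∃[ r ] ((2 ≤ n ∸ r) × (G ≅ KsqcupK1 n r)) in
    (cond1 ⇔ zir≡ G (n ∸ 1)) × (cond1 ⇔ Z≡ G (n ∸ 1))
      × (cond1 ⇔ Zbar≡ G (n ∸ 1)) × (cond1 ⇔ ZIR≡ G (n ∸ 1))
proposition5p2 n 2≤n G =
    via (CliquePlusIsolated⇔zir≡n∸1 G 1≤n) , via (CliquePlusIsolated⇔Z≡n∸1 G 1≤n)
  , via (CliquePlusIsolated⇔Zbar≡n∸1 G 1≤n) , via (CliquePlusIsolated⇔ZIR≡n∸1 G 1≤n)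
  where
  1≤n : 1 ≤ n
  1≤n = <⇒≤ 2≤n
  via : {P : Set} → CliquePlusIsolated G ⇔ P → (∃[ r ] ((2 ≤ n ∸ r) × (G ≅ KsqcupK1 n r))) ⇔ P
  via = ⇔-trans (≅KsqcupK1⇔CliquePlusIsolated G)
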